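{- The algorithm Greedy has no approximation guarantee for group closeness centrality maximization: for every $\varepsilon>0$ there exist a finite, undirected, unweighted, connected graph $G=(V,E)$ and a positive integer $k$ such that Greedy can return a set $S_G$ with $c(S_G)<\varepsilon\cdot \max\{c(S): S\subseteq V,\ |S|=k\}$.
   Context: For $S\subseteq V$ nonempty, $\mathrm{dist}(u,S)=\min_{s\in S}\mathrm{dist}(u,s)$ (shortest-path distance), group farness is $f(S)=\sum_{u\in V}\mathrm{dist}(u,S)$ and group closeness centrality is $c(S)=(|V|-|S|)/f(S)$. Group closeness centrality maximization: given $G$ and $k$, find $S\subseteq V$ with $|S|=k$ maximizing $c(S)$. Greedy: start with $S_0=\emptyset$ and for $i=1,\dots,k$ set $S_i=S_{i-1}\cup\{v\}$ where $v$ maximizes $c(S_{i-1}\cup\{v\})$ over $v\in V\setminus S_{i-1}$ (ties broken arbitrarily); return $S_G=S_k$.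
   Formalization: The parameter ε ranges over the positive rationals. -}

module Defs where

open import Data.Nat using (ℕ; zero; suc; _∸_)
open import Data.Bool using (Bool; true; false; _∨_; _∧_; if_then_else_)
open import Data.Fin using (Fin)
open import Data.Fin.Subset using (Subset; _∪_; ⁅_⁆; ⊥; ∣_∣; _∉_)
open import Data.Vec using (lookup; tabulate)
open import Data.Vec using () renaming (sum to vsum)
open import Data.Integer using (+_)
open import Data.Rational using (ℚ; _/_; 0ℚ; _≤_)
open import Relation.Binary.PropositionalEquality using (_≡_)
open import Relation.Binary.Construct.Closure.ReflexiveTransitive using (Star)

record Graph (n : ℕ) : Set where
  field
    adj     : Fin n → Fin n → Bool
    sym     : ∀ u v → adj u v ≡ adj v u
    irrefl  : ∀ u → adj u u ≡ false

open Graph public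

Adj : ∀ {n} → Graph n → Fin n → Fin n → Set
Adj G u v = adj G u v ≡ true

Connected : ∀ {n} → Graph n → Set
Connected G = ∀ u v → Star (Adj G) u v

anyFin : ∀ {n} → (Fin n → Bool) → Bool
anyFin {zero}  f = false
anyFin {suc n} f = f Fin.zero ∨ anyFin (λ w → f (Fin.suc w))

-- within G d S u = true iff dist(u, S) ≤ d  (u reachable from S in at most d edges)
within : ∀ {n} → Graph n → ℕ → Subset n → Fin n → Bool
within G zero    S u = lookup S u
within G (suc d) S u = within G d S u ∨ anyFin (λ w → adj G u w ∧ within G d S w)

-- least d' ≥ d (searching at most fuel values) with within G d' S u; returns d+fuel if none
minDist : ∀ {n} → Graph n → Subset n → Fin n → ℕ → ℕ → ℕ
minDist G S u zero       d = d
minDist G S u (suc fuel) d = if within G d S u then d else minDist G S u fuel (suc d)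

-- shortest-path distance dist(u,S) = min { d : dist(u,S) ≤ d }.
-- In a connected graph with S nonempty this minimum is < n, so the search over
-- d = 0,…,n-1 finds it.
dist : ∀ {n} → Graph n → Subset n → Fin n → ℕ
dist {n} G S u = minDist G S u n 0

farness : ∀ {n} → Graph n → Subset n → ℕ
farness {n} G S = vsum (tabulate (dist G S))

-- (n - |S|) / f, with the (never used: f(S) = 0 only when S = V) convention 0 if f = 0
ratio : ℕ → ℕ → ℚ
ratio a zero    = 0ℚ
ratio a (suc m) = (+ a) / suc m

closeness : ∀ {n} → Graph n → Subset n → ℚ
closeness {n} G S = ratio (n ∸ ∣ S ∣) (farness G S)

-- GreedyRun G i S : S is a possible value of S_i in some run of Greedy
-- (ties broken arbitrarily).
data GreedyRun {n} (G : Graph n) : ℕ → Subset n → Set where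
  start : GreedyRun G 0 ⊥
  step  : ∀ {i S} (v : Fin n) → GreedyRun G i S → v ∉ S →
          (∀ w → w ∉ S → closeness G (S ∪ ⁅ w ⁆) ≤ closeness G (S ∪ ⁅ v ⁆)) →
          GreedyRun G (suc i) (S ∪ ⁅ v ⁆)

module Submission where

-- On a double broom, a path on P = 2t + 1 vertices with m leaves attached to each end,
-- Greedy first picks the middle vertex c of the path. Indeed the reflection ρ of the broom
-- satisfies d(i, ρ i) = 2 d(i, c), so for every vertex w
--   2 Σ d(i, c) = Σ d(i, ρ i) ≤ Σ (d(i, w) + d(w, ρ i)) = 2 Σ d(i, w).
-- Whatever Greedy adds next, the leaves at one end stay at distance ≥ t + 1 from the chosen
-- pair, so its farness is at least m (t + 1), whereas every leaf is adjacent to one of the two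
-- ends of the path, which therefore have farness at most 2m + P (P + 1). For m = P (P + 1) and
-- t large the ratio of the closeness values is as small as desired. Distances in the broom
-- have a closed form in terms of the levels of the vertices.

module GreedyCounterexample where

  open import Data.Bool using (Bool; true; false; _∨_; _∧_; if_then_else_)
  open import Data.Bool.Properties using (∨-zeroʳ; ∧-conicalˡ; ∧-conicalʳ)
  open import Data.Fin using (Fin; toℕ; fromℕ<)
  open import Data.Fin.Properties using (toℕ-fromℕ<; toℕ-injective; toℕ<n)
  open import Data.Fin.Subset using (Subset; _∈_; _∉_; _∪_; ⁅_⁆; ⊥; ∣_∣; inside; outside)
  open import Data.Fin.Subset.Properties using (_∈?_; ∉⊥; x∈⁅x⁆; x∈⁅y⁆⇒x≡y; x∈p∪q⁻; x∈p∪q⁺; ∪-identityʳ; ∣⊥∣≡0)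
  import Data.Integer as ℤ
  import Data.Integer.Properties as ℤ
  open import Data.List using (List; map; _++_; filter; allFin; [_])
  open import Data.List.Membership.Propositional using () renaming (_∈_ to _∈ˡ_)
  open import Data.List.Membership.Propositional.Properties using (∈-filter⁺; ∈-allFin; ∈-map⁺; ∈-++⁺ˡ; ∈-++⁺ʳ)
  open import Data.List.Relation.Unary.All using () renaming (lookup to All-lookup)
  open import Data.List.Relation.Unary.All.Properties using (all-filter)
  open import Data.List.Relation.Unary.Any using () renaming (here to hereˡ)
  open import Data.Nat using (ℕ; zero; suc; _+_; _*_; _∸_; _≤_; _<_; _⊓_; _⊔_; ∣_-_∣; z≤n; s≤s; NonZero; >-nonZero⁻¹)
  open import Data.Nat.Coprimality using (Coprime)
  open import Data.Nat.Properties
  open import Algebra.Properties.CommutativeSemigroup +-commutativeSemigroup using () renaming (interchange to +-interchange)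
  open import Data.Nat.Tactic.RingSolver using (solve-∀)
  open import Data.Product using (Σ; ∃-syntax; _×_; _,_; proj₁; proj₂)
  open import Data.Rational as ℚ using (ℚ; mkℚ; toℚᵘ)
  import Data.Rational.Properties as ℚ
  open import Data.Rational.Unnormalised as ℚᵘ using (mkℚᵘ; *≤*; *<*)
  import Data.Rational.Unnormalised.Properties as ℚᵘ
  open import Data.Sum using (_⊎_; inj₁; inj₂)
  open import Data.Vec using ([]; _∷_; here; there; lookup; tabulate) renaming (sum to vsum)
  open import Data.Vec.Properties using ([]=⇒lookup; lookup⇒[]=)
  open import Defs hiding (sym)
  open import Function using (_∘_)
  open import Level using (0ℓ)
  open import Relation.Binary.Bundles using (DecTotalOrder)
  open import Relation.Binary.Construct.Closure.ReflexiveTransitive as Star using (Star; _◅_)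
  open import Relation.Binary.PropositionalEquality using (_≡_; _≢_; refl; sym; trans; cong; cong₂; subst; subst₂; module ≡-Reasoning)
  open import Relation.Nullary using (¬?; contradiction; Dec; yes; no; does)
  open import Relation.Nullary.Decidable using (dec-true; dec-false)
  open import Relation.Unary using (Pred; Decidable)
  open import Data.List.Extrema (DecTotalOrder.totalOrder ℚ.≤-decTotalOrder) using (argmax; f[xs]≤f[argmax]; argmax-all)

  [m+m+m]*s≡m*[3*s] : ∀ m s → (m + (m + m)) * s ≡ m * (3 * s)
  [m+m+m]*s≡m*[3*s] = solve-∀

  ∣n-1+n∣≡1 : ∀ n → ∣ n - suc n ∣ ≡ 1
  ∣n-1+n∣≡1 zero    = refl
  ∣n-1+n∣≡1 (suc n) = ∣n-1+n∣≡1 n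

  ∃-neighbour : ∀ {a T} → 1 ≤ T → a ≤ T → ∃[ q ] q ≤ T × ∣ a - q ∣ ≡ 1
  ∃-neighbour {zero}  1≤T _   = 1 , 1≤T , refl
  ∃-neighbour {suc a} _   a<T = a , <⇒≤ a<T , trans (∣-∣-comm (suc a) a) (∣n-1+n∣≡1 a)

  ∃-step-toward : ∀ a b {d} → ∣ a - b ∣ ≡ suc d → ∃[ q ] q ≤ a ⊔ b × ∣ a - q ∣ ≡ 1 × ∣ q - b ∣ ≡ d
  ∃-step-toward zero    (suc b) refl = 1 , s≤s z≤n , refl , refl
  ∃-step-toward (suc a) zero    refl = a , n≤1+n a , trans (∣-∣-comm (suc a) a) (∣n-1+n∣≡1 a) , ∣-∣-identityʳ a
  ∃-step-toward (suc a) (suc b) e with ∃-step-toward a b e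
  ... | q , q≤a⊔b , ∣a-q∣≡1 , ∣q-b∣≡d = suc q , s≤s q≤a⊔b , ∣a-q∣≡1 , ∣q-b∣≡d

  ∣a-b∣≡2*∣a-h∣ : ∀ a b h → a + b ≡ 2 * h → ∣ a - b ∣ ≡ 2 * ∣ a - h ∣
  ∣a-b∣≡2*∣a-h∣ a b h a+b≡2h = begin
    ∣ a - b ∣          ≡⟨ ∣m+n-m+o∣≡∣n-o∣ a a b ⟨
    ∣ a + a - a + b ∣  ≡⟨ cong₂ ∣_-_∣ (cong (a +_) (sym (+-identityʳ a))) a+b≡2h ⟩
    ∣ 2 * a - 2 * h ∣  ≡⟨ *-distribˡ-∣-∣ 2 a h ⟨
    2 * ∣ a - h ∣      ∎
    where open ≡-Reasoning

  clamp-top : ∀ m T {b} → b ≡ m + (T + m) → (b ∸ m) ⊓ T ≡ T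
  clamp-top m T refl = m≥n⇒m⊓n≡n (begin
    T                ≤⟨ m≤m+n T m ⟩
    T + m            ≡⟨ m+n∸m≡n m (T + m) ⟨
    m + (T + m) ∸ m  ∎)
    where open ≤-Reasoning

  clamp-reflect : ∀ m T {a b} → a + b ≡ m + (T + m) → (a ∸ m) ⊓ T + (b ∸ m) ⊓ T ≡ T
  clamp-reflect zero T {a} {b} a+b≡T+0 = begin
    a ⊓ T + b ⊓ T  ≡⟨ cong₂ _+_ (m≤n⇒m⊓n≡m (m+n≤o⇒m≤o a a+b≤T)) (m≤n⇒m⊓n≡m (m+n≤o⇒n≤o a a+b≤T)) ⟩
    a + b          ≡⟨ a+b≡T ⟩
    T              ∎
    where
    open ≡-Reasoning
    a+b≡T = trans a+b≡T+0 (+-identityʳ T)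
    a+b≤T = ≤-reflexive a+b≡T
  clamp-reflect (suc m) T {zero}  e = clamp-top (suc m) T e
  clamp-reflect (suc m) T {suc a} {zero} e =
    trans (+-identityʳ _) (clamp-top (suc m) T (trans (sym (+-identityʳ (suc a))) e))
  clamp-reflect (suc m) T {suc a} {suc b} e = clamp-reflect m T (suc-injective (begin
    suc (a + b)        ≡⟨ +-suc a b ⟨
    a + suc b          ≡⟨ suc-injective e ⟩
    m + (T + suc m)    ≡⟨ cong (m +_) (+-suc T m) ⟩
    m + suc (T + m)    ≡⟨ +-suc m (T + m) ⟩
    suc (m + (T + m))  ∎))
    where open ≡-Reasoning

  ∑< : ℕ → (ℕ → ℕ) → ℕ
  ∑< zero    F = 0
  ∑< (suc n) F = F 0 + ∑< n (F ∘ suc)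

  syntax ∑< n (λ i → x) = ∑[ i < n ] x

  ∑-mono-≤ : ∀ n {F G : ℕ → ℕ} → (∀ {i} → i < n → F i ≤ G i) → ∑< n F ≤ ∑< n G
  ∑-mono-≤ zero    F≤G = z≤n
  ∑-mono-≤ (suc n) F≤G = +-mono-≤ (F≤G (s≤s z≤n)) (∑-mono-≤ n (F≤G ∘ s≤s))

  ∑-cong : ∀ n {F G : ℕ → ℕ} → (∀ {i} → i < n → F i ≡ G i) → ∑< n F ≡ ∑< n G
  ∑-cong zero    F≡G = refl
  ∑-cong (suc n) F≡G = cong₂ _+_ (F≡G (s≤s z≤n)) (∑-cong n (F≡G ∘ s≤s))

  ∑-distrib-+ : ∀ n (F G : ℕ → ℕ) → ∑[ i < n ] (F i + G i) ≡ ∑< n F + ∑< n G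
  ∑-distrib-+ zero    F G = refl
  ∑-distrib-+ (suc n) F G = trans (cong (F 0 + G 0 +_) (∑-distrib-+ n (F ∘ suc) (G ∘ suc)))
                                  (+-interchange (F 0) (G 0) _ _)

  ∑-*ˡ : ∀ n k (F : ℕ → ℕ) → ∑[ i < n ] (k * F i) ≡ k * ∑< n F
  ∑-*ˡ zero    k F = sym (*-zeroʳ k)
  ∑-*ˡ (suc n) k F = trans (cong (k * F 0 +_) (∑-*ˡ n k (F ∘ suc))) (sym (*-distribˡ-+ k (F 0) _))

  ∑-++ : ∀ a b (F : ℕ → ℕ) → ∑< (a + b) F ≡ ∑< a F + ∑[ i < b ] F (a + i)
  ∑-++ zero    b F = refl
  ∑-++ (suc a) b F = trans (cong (F 0 +_) (∑-++ a b (F ∘ suc))) (sym (+-assoc (F 0) _ _))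

  ∑-const : ∀ n k → ∑[ i < n ] k ≡ n * k
  ∑-const zero    k = refl
  ∑-const (suc n) k = cong (k +_) (∑-const n k)

  *≤∑ : ∀ a k {F : ℕ → ℕ} → (∀ {i} → i < a → k ≤ F i) → a * k ≤ ∑< a F
  *≤∑ a k k≤F = subst (_≤ _) (∑-const a k) (∑-mono-≤ a k≤F)

  ∑≤* : ∀ a k {F : ℕ → ℕ} → (∀ {i} → i < a → F i ≤ k) → ∑< a F ≤ a * k
  ∑≤* a k F≤k = subst (_ ≤_) (∑-const a k) (∑-mono-≤ a F≤k)

  ∑-++-++ : ∀ a b c (F : ℕ → ℕ) →
            ∑< (a + (b + c)) F ≡ ∑< a F + (∑[ j < b ] F (a + j) + ∑[ j < c ] F (a + (b + j)))
  ∑-++-++ a b c F = trans (∑-++ a (b + c) F) (cong (∑< a F +_) (∑-++ b c (F ∘ (a +_))))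

  ∑-prefix : ∀ a b (F : ℕ → ℕ) → ∑< a F ≤ ∑< (a + b) F
  ∑-prefix a b F = ≤-trans (m≤m+n _ _) (≤-reflexive (sym (∑-++ a b F)))

  ∑-suffix : ∀ a b (F : ℕ → ℕ) → ∑[ j < b ] F (a + j) ≤ ∑< (a + b) F
  ∑-suffix a b F = ≤-trans (m≤n+m _ (∑< a F)) (≤-reflexive (sym (∑-++ a b F)))

  ∑-last : ∀ n (F : ℕ → ℕ) → ∑< (suc n) F ≡ ∑< n F + F n
  ∑-last n F = begin
    ∑< (suc n) F              ≡⟨ cong (λ k → ∑< k F) (+-comm 1 n) ⟩
    ∑< (n + 1) F              ≡⟨ ∑-++ n 1 F ⟩
    ∑< n F + (F (n + 0) + 0)  ≡⟨ cong (∑< n F +_) (trans (+-identityʳ _) (cong F (+-identityʳ n))) ⟩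
    ∑< n F + F n              ∎
    where open ≡-Reasoning

  ∑-reverse : ∀ n (F : ℕ → ℕ) → ∑[ i < n ] F (n ∸ suc i) ≡ ∑< n F
  ∑-reverse zero    F = refl
  ∑-reverse (suc n) F = begin
    F n + ∑[ i < n ] F (n ∸ suc i)  ≡⟨ cong (F n +_) (∑-reverse n F) ⟩
    F n + ∑< n F                    ≡⟨ +-comm (F n) _ ⟩
    ∑< n F + F n                    ≡⟨ ∑-last n F ⟨
    ∑< (suc n) F                    ∎
    where open ≡-Reasoning

  ∑-tabulate : ∀ {n} (f : Fin n → ℕ) (F : ℕ → ℕ) → (∀ u → f u ≡ F (toℕ u)) → vsum (tabulate f) ≡ ∑< n F
  ∑-tabulate {zero}  f F f≡F = refl
  ∑-tabulate {suc n} f F f≡F = cong₂ _+_ (f≡F Fin.zero) (∑-tabulate (f ∘ Fin.suc) (F ∘ suc) (f≡F ∘ Fin.suc))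

  term≤vsum-tabulate : ∀ {n} (f : Fin n → ℕ) u → f u ≤ vsum (tabulate f)
  term≤vsum-tabulate f Fin.zero    = m≤m+n _ _
  term≤vsum-tabulate f (Fin.suc u) = ≤-trans (term≤vsum-tabulate (f ∘ Fin.suc) u) (m≤n+m _ (f Fin.zero))

  halfway-median : ∀ n (d : ℕ → ℕ → ℕ) {c w} →
    (∀ i j → d i j ≡ d j i) →
    (∀ {i} → i < n → d i (n ∸ suc i) ≤ d i w + d w (n ∸ suc i)) →
    (∀ {i} → i < n → 2 * d i c ≤ d i (n ∸ suc i)) →
    ∑[ i < n ] d i c ≤ ∑[ i < n ] d i w
  halfway-median n d {c} {w} d-sym triangle halfway = *-cancelˡ-≤ 2 (begin
    2 * ∑[ i < n ] d i c                     ≡⟨ ∑-*ˡ n 2 (λ i → d i c) ⟨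
    ∑[ i < n ] (2 * d i c)                   ≤⟨ ∑-mono-≤ n halfway ⟩
    ∑[ i < n ] d i (ρ i)                     ≤⟨ ∑-mono-≤ n triangle ⟩
    ∑[ i < n ] (d i w + d w (ρ i))           ≡⟨ ∑-distrib-+ n (λ i → d i w) (λ i → d w (ρ i)) ⟩
    ∑[ i < n ] d i w + ∑[ i < n ] d w (ρ i)  ≡⟨ cong (∑[ i < n ] d i w +_) (trans (∑-cong n (λ {i} _ → d-sym w (ρ i))) (∑-reverse n (λ j → d j w))) ⟩
    ∑[ i < n ] d i w + ∑[ i < n ] d i w      ≡⟨ cong (∑[ i < n ] d i w +_) (+-identityʳ _) ⟨
    2 * ∑[ i < n ] d i w                     ∎)
    where
    open ≤-Reasoning
    ρ : ℕ → ℕ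
    ρ i = n ∸ suc i

  ∣p∪⁅x⁆∣≡1+∣p∣ : ∀ {n} (p : Subset n) {x} → x ∉ p → ∣ p ∪ ⁅ x ⁆ ∣ ≡ suc ∣ p ∣
  ∣p∪⁅x⁆∣≡1+∣p∣ (inside  ∷ p) {Fin.zero}  x∉p = contradiction here x∉p
  ∣p∪⁅x⁆∣≡1+∣p∣ (outside ∷ p) {Fin.zero}  x∉p = cong (suc ∘ ∣_∣) (∪-identityʳ p)
  ∣p∪⁅x⁆∣≡1+∣p∣ (inside  ∷ p) {Fin.suc x} x∉p = cong suc (∣p∪⁅x⁆∣≡1+∣p∣ p (x∉p ∘ there))
  ∣p∪⁅x⁆∣≡1+∣p∣ (outside ∷ p) {Fin.suc x} x∉p = ∣p∪⁅x⁆∣≡1+∣p∣ p (x∉p ∘ there)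

  x∈⊥∪⁅x⁆ : ∀ {n} (x : Fin n) → x ∈ ⊥ ∪ ⁅ x ⁆
  x∈⊥∪⁅x⁆ x = x∈p∪q⁺ (inj₂ (x∈⁅x⁆ x))

  x∈⊥∪⁅y⁆⇒x≡y : ∀ {n} {x y : Fin n} → x ∈ ⊥ ∪ ⁅ y ⁆ → x ≡ y
  x∈⊥∪⁅y⁆⇒x≡y {y = y} x∈ with x∈p∪q⁻ ⊥ ⁅ y ⁆ x∈
  ... | inj₁ x∈⊥ = contradiction x∈⊥ ∉⊥
  ... | inj₂ x∈y = x∈⁅y⁆⇒x≡y y x∈y

  x∈pair⇒ : ∀ {n} {x a b : Fin n} → x ∈ (⊥ ∪ ⁅ a ⁆) ∪ ⁅ b ⁆ → x ≡ a ⊎ x ≡ b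
  x∈pair⇒ {a = a} {b} x∈ with x∈p∪q⁻ (⊥ ∪ ⁅ a ⁆) ⁅ b ⁆ x∈
  ... | inj₁ x∈a = inj₁ (x∈⊥∪⁅y⁆⇒x≡y x∈a)
  ... | inj₂ x∈b = inj₂ (x∈⁅y⁆⇒x≡y b x∈b)

  ∣⊥∪⁅x⁆∣≡1 : ∀ {n} (x : Fin n) → ∣ ⊥ ∪ ⁅ x ⁆ ∣ ≡ 1
  ∣⊥∪⁅x⁆∣≡1 {n} x = trans (∣p∪⁅x⁆∣≡1+∣p∣ ⊥ {x} ∉⊥) (cong suc (∣⊥∣≡0 n))

  ∣pair∣≡2 : ∀ {n} {a b : Fin n} → a ≢ b → ∣ (⊥ ∪ ⁅ a ⁆) ∪ ⁅ b ⁆ ∣ ≡ 2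
  ∣pair∣≡2 {a = a} a≢b = trans (∣p∪⁅x⁆∣≡1+∣p∣ (⊥ ∪ ⁅ a ⁆) (a≢b ∘ sym ∘ x∈⊥∪⁅y⁆⇒x≡y)) (cong suc (∣⊥∪⁅x⁆∣≡1 a))

  anyFin-true⇒ : ∀ {n} (f : Fin n → Bool) → anyFin f ≡ true → ∃[ w ] f w ≡ true
  anyFin-true⇒ {suc n} f any-f with f Fin.zero in f0
  ... | true  = Fin.zero , f0
  ... | false with anyFin-true⇒ (f ∘ Fin.suc) any-f
  ...   | w , fw = Fin.suc w , fw

  anyFin-true⇐ : ∀ {n} (f : Fin n → Bool) w → f w ≡ true → anyFin f ≡ true
  anyFin-true⇐ f Fin.zero    fw rewrite fw = refl
  anyFin-true⇐ f (Fin.suc w) fw rewrite anyFin-true⇐ (f ∘ Fin.suc) w fw = ∨-zeroʳ _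

  module _ {n} (G : Graph n) (S : Subset n) (u : Fin n) where

    minDist-exact : ∀ fuel {d k} → d ≤ k → k < d + fuel → within G k S u ≡ true →
                    (∀ {d'} → d' < k → within G d' S u ≢ true) → minDist G S u fuel d ≡ k
    minDist-exact zero    {d} d≤k k<d+0 _ _ = contradiction (≤-trans k<d+0 (≤-reflexive (+-identityʳ d))) (≤⇒≯ d≤k)
    minDist-exact (suc fuel) {d} d≤k k<d+fuel within-k below with within G d S u in within-d | m≤n⇒m<n∨m≡n d≤k
    ... | true  | inj₁ d<k = contradiction within-d (below d<k)
    ... | true  | inj₂ d≡k = d≡k
    ... | false | inj₁ d<k = minDist-exact fuel d<k (≤-trans k<d+fuel (≤-reflexive (+-suc d fuel))) within-k below
    ... | false | inj₂ refl with () ← trans (sym within-d) within-k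

    d≤minDist : ∀ fuel d → d ≤ minDist G S u fuel d
    d≤minDist zero       d = ≤-refl
    d≤minDist (suc fuel) d with within G d S u
    ... | true  = ≤-refl
    ... | false = ≤-trans (n≤1+n d) (d≤minDist fuel (suc d))

  1≤dist : ∀ {n} (G : Graph n) {S u} → u ∉ S → 1 ≤ dist G S u
  1≤dist {suc n} G {S} {u} u∉S with lookup S u in u∈?S
  ... | true  = contradiction (lookup⇒[]= u S u∈?S) u∉S
  ... | false = d≤minDist G S u n 1

  1≤farness : ∀ {n} (G : Graph n) {S u} → u ∉ S → 1 ≤ farness G S
  1≤farness G {S} {u} u∉S = ≤-trans (1≤dist G u∉S) (term≤vsum-tabulate (dist G S) u)

  module DistanceCertificate {n} (G : Graph n) (δ : Fin n → Fin n → ℕ)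
    (δ<n       : ∀ u v → δ u v < n)
    (δ-refl    : ∀ u → δ u u ≡ 0)
    (δ≡0⇒≡     : ∀ {u v} → δ u v ≡ 0 → u ≡ v)
    (δ-edge    : ∀ {u v} x → Adj G u v → δ u x ≤ suc (δ v x))
    (δ-descent : ∀ {u x d} → δ u x ≡ suc d → ∃[ v ] Adj G u v × δ v x ≡ d)
    where

    within-sound : ∀ d {S u} → within G d S u ≡ true → ∃[ s ] s ∈ S × δ u s ≤ d
    within-sound zero    {S} {u} u∈S = u , lookup⇒[]= u S u∈S , ≤-reflexive (δ-refl u)
    within-sound (suc d) {S} {u} within-u with within G d S u in within-d
    ... | true with within-sound d within-d
    ...   | s , s∈S , δ≤d = s , s∈S , m≤n⇒m≤1+n δ≤d
    within-sound (suc d) {S} {u} within-u | false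
      with anyFin-true⇒ (λ w → adj G u w ∧ within G d S w) within-u
    ... | w , u~w∧within-w with within-sound d (∧-conicalʳ _ _ u~w∧within-w)
    ...   | s , s∈S , δ≤d = s , s∈S , ≤-trans (δ-edge s (∧-conicalˡ _ _ u~w∧within-w)) (s≤s δ≤d)

    within-complete : ∀ d {S u s} → s ∈ S → δ u s ≤ d → within G d S u ≡ true
    within-complete zero    {S} {u} s∈S δ≤0 rewrite δ≡0⇒≡ (n≤0⇒n≡0 δ≤0) = []=⇒lookup s∈S
    within-complete (suc d) {S} {u} s∈S δ≤1+d with m≤n⇒m<n∨m≡n δ≤1+d
    ... | inj₁ (s≤s δ≤d) rewrite within-complete d s∈S δ≤d = refl
    ... | inj₂ δ≡1+d with δ-descent δ≡1+d
    ...   | v , u~v , δv≡d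
      rewrite anyFin-true⇐ (λ w → adj G u w ∧ within G d S w) v
                (cong₂ _∧_ u~v (within-complete d s∈S (≤-reflexive δv≡d))) = ∨-zeroʳ _

    dist-nearest : ∀ {S u s} → s ∈ S → (∀ {s'} → s' ∈ S → δ u s ≤ δ u s') → dist G S u ≡ δ u s
    dist-nearest {S} {u} {s} s∈S nearest =
      minDist-exact G S u n z≤n (δ<n u s) (within-complete (δ u s) s∈S ≤-refl) none-closer
      where
      none-closer : ∀ {d} → d < δ u s → within G d S u ≢ true
      none-closer d<δ within-d with within-sound _ within-d
      ... | s' , s'∈S , δ'≤d = <⇒≱ (≤-trans (s≤s δ'≤d) d<δ) (nearest s'∈S)

    dist-singleton : ∀ {u w} → dist G (⊥ ∪ ⁅ w ⁆) u ≡ δ u w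
    dist-singleton {u} {w} = dist-nearest (x∈⊥∪⁅x⁆ w) λ s∈ → ≤-reflexive (cong (δ u) (sym (x∈⊥∪⁅y⁆⇒x≡y s∈)))

    ⊓≤δ-pair : ∀ {u a b s} → s ∈ (⊥ ∪ ⁅ a ⁆) ∪ ⁅ b ⁆ → δ u a ⊓ δ u b ≤ δ u s
    ⊓≤δ-pair {u} {a} {b} s∈ with x∈pair⇒ s∈
    ... | inj₁ refl = m⊓n≤m (δ u a) (δ u b)
    ... | inj₂ refl = m⊓n≤n (δ u a) (δ u b)

    dist-pair : ∀ {u a b} → dist G ((⊥ ∪ ⁅ a ⁆) ∪ ⁅ b ⁆) u ≡ δ u a ⊓ δ u b
    dist-pair {u} {a} {b} with ⊓-sel (δ u a) (δ u b)
    ... | inj₁ ⊓≡δa = trans (dist-nearest (x∈p∪q⁺ (inj₁ (x∈⊥∪⁅x⁆ a))) (subst (_≤ _) ⊓≡δa ∘ ⊓≤δ-pair)) (sym ⊓≡δa)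
    ... | inj₂ ⊓≡δb = trans (dist-nearest (x∈p∪q⁺ (inj₂ (x∈⁅x⁆ b))) (subst (_≤ _) ⊓≡δb ∘ ⊓≤δ-pair)) (sym ⊓≡δb)

    δ-triangle : ∀ u w v → δ u v ≤ δ u w + δ w v
    δ-triangle u w v = along refl
      where
      along : ∀ {k u} → δ u w ≡ k → δ u v ≤ k + δ w v
      along {zero}  δ≡0 rewrite δ≡0⇒≡ δ≡0 = ≤-refl
      along {suc k} δ≡1+k with δ-descent δ≡1+k
      ... | u' , u~u' , δ'≡k = ≤-trans (δ-edge v u~u') (s≤s (along δ'≡k))

    connected : Connected G
    connected u v = walk refl
      where
      walk : ∀ {k u} → δ u v ≡ k → Star (Adj G) u v
      walk {zero}  δ≡0 rewrite δ≡0⇒≡ δ≡0 = Star.ε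
      walk {suc k} δ≡1+k with δ-descent δ≡1+k
      ... | u' , u~u' , δ'≡k = u~u' ◅ walk δ'≡k

  maximiser : ∀ {A : Set} {P : Pred A 0ℓ} → Decidable P → (f : A → ℚ) (xs : List A) →
              (∀ x → x ∈ˡ xs) → ∀ {x₀} → P x₀ → ∃[ y ] P y × (∀ x → P x → f x ℚ.≤ f y)
  maximiser P? f xs complete {x₀} Px₀ =
    y , argmax-all f Px₀ (all-filter P? xs) ,
    λ x Px → All-lookup (f[xs]≤f[argmax] x₀ candidates) (∈-filter⁺ P? (complete x) Px)
    where
    candidates = filter P? xs
    y = argmax f x₀ candidates

  allSubsets : ∀ n → List (Subset n)
  allSubsets zero    = [ [] ]
  allSubsets (suc n) = map (inside ∷_) (allSubsets n) ++ map (outside ∷_) (allSubsets n)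

  ∈-allSubsets : ∀ {n} (S : Subset n) → S ∈ˡ allSubsets n
  ∈-allSubsets []            = hereˡ refl
  ∈-allSubsets (inside  ∷ S) = ∈-++⁺ˡ (∈-map⁺ (inside ∷_) (∈-allSubsets S))
  ∈-allSubsets (outside ∷ S) = ∈-++⁺ʳ (map (inside ∷_) (allSubsets _)) (∈-map⁺ (outside ∷_) (∈-allSubsets S))

  greedy-step : ∀ {n} {G : Graph n} {i S} → GreedyRun G i S → ∀ {w} → w ∉ S →
                ∃[ v ] v ∉ S × GreedyRun G (suc i) (S ∪ ⁅ v ⁆)
  greedy-step {G = G} {S = S} run w∉S
    with maximiser (λ w → ¬? (w ∈? S)) (λ w → closeness G (S ∪ ⁅ w ⁆)) (allFin _) ∈-allFin w∉S
  ... | v , v∉S , v-best = v , v∉S , step v run v∉S v-best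

  optimum : ∀ {n} (G : Graph n) {k S₀} → ∣ S₀ ∣ ≡ k →
            ∃[ S ] ∣ S ∣ ≡ k × (∀ S' → ∣ S' ∣ ≡ k → closeness G S' ℚ.≤ closeness G S)
  optimum G {k} {S₀} = maximiser (λ S → ∣ S ∣ ≟ k) (closeness G) (allSubsets _) ∈-allSubsets {S₀}

  toℚᵘ-ratio : ∀ a x → toℚᵘ (ratio a (suc x)) ℚᵘ.≃ mkℚᵘ (ℤ.+ a) x
  toℚᵘ-ratio a x = ℚ.toℚᵘ-fromℚᵘ (mkℚᵘ (ℤ.+ a) x)

  ratio-antitone : ∀ a {x y} → 1 ≤ x → x ≤ y → ratio a y ℚ.≤ ratio a x
  ratio-antitone a {suc x} {suc y} _ x≤y = ℚ.toℚᵘ-cancel-≤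
    (ℚᵘ.≤-respʳ-≃ (ℚᵘ.≃-sym (toℚᵘ-ratio a x)) (ℚᵘ.≤-respˡ-≃ (ℚᵘ.≃-sym (toℚᵘ-ratio a y))
      (*≤* (subst₂ ℤ._≤_ (ℤ.pos-* a (suc x)) (ℤ.pos-* a (suc y)) (ℤ.+≤+ (*-monoʳ-≤ a x≤y))))))

  ratio<ε*ratio : ∀ {a x y p q} .(cp : Coprime (suc p) (suc q)) → 1 ≤ a → 1 ≤ x → 1 ≤ y →
                  y * suc q < suc p * x → ratio a x ℚ.< mkℚ (ℤ.+ suc p) q cp ℚ.* ratio a y
  ratio<ε*ratio {a@(suc _)} {suc x} {suc y} {p} {q} cp _ _ _ yq<px = ℚ.toℚᵘ-cancel-<
    (ℚᵘ.<-respʳ-≃ (ℚᵘ.≃-sym toℚᵘ-rhs) (ℚᵘ.<-respˡ-≃ (ℚᵘ.≃-sym (toℚᵘ-ratio a x)) (*<* cross-ℤ)))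
    where
    ε = mkℚ (ℤ.+ suc p) q cp
    toℚᵘ-rhs : toℚᵘ (ε ℚ.* ratio a (suc y)) ℚᵘ.≃ mkℚᵘ (ℤ.+ suc p) q ℚᵘ.* mkℚᵘ (ℤ.+ a) y
    toℚᵘ-rhs = ℚᵘ.≃-trans (ℚ.toℚᵘ-homo-* ε (ratio a (suc y))) (ℚᵘ.*-congˡ {mkℚᵘ (ℤ.+ suc p) q} (toℚᵘ-ratio a y))
    cross-ℕ : a * (suc q * suc y) < (suc p * a) * suc x
    cross-ℕ = subst₂ _<_ (cong (a *_) (*-comm (suc y) (suc q)))
                (trans (sym (*-assoc a (suc p) (suc x))) (cong (_* suc x) (*-comm a (suc p))))
                (*-monoʳ-< a yq<px)
    cross-ℤ = subst₂ ℤ._<_ (ℤ.pos-* a (suc q * suc y))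
                (trans (ℤ.pos-* (suc p * a) (suc x)) (cong (ℤ._* ℤ.+ suc x) (ℤ.pos-* (suc p) a)))
                (ℤ.+<+ cross-ℕ)

  levelGraph : ∀ {n} → (Fin n → ℕ) → Graph n
  levelGraph ℓ = record
    { adj    = λ u v → does (∣ ℓ u - ℓ v ∣ ≟ 1)
    ; sym    = λ u v → cong (λ d → does (d ≟ 1)) (∣-∣-comm (ℓ u) (ℓ v))
    ; irrefl = λ u → cong (λ d → does (d ≟ 1)) (∣n-n∣≡0 (ℓ u))
    }

  module _ {n} (ℓ : Fin n → ℕ) {u v : Fin n} where

    levelGraph-adj⁺ : ∣ ℓ u - ℓ v ∣ ≡ 1 → Adj (levelGraph ℓ) u v
    levelGraph-adj⁺ = dec-true (∣ ℓ u - ℓ v ∣ ≟ 1)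

    levelGraph-adj⁻ : Adj (levelGraph ℓ) u v → ∣ ℓ u - ℓ v ∣ ≡ 1
    levelGraph-adj⁻ = witness (∣ ℓ u - ℓ v ∣ ≟ 1)
      where
      witness : ∀ {A : Set} (a? : Dec A) → does a? ≡ true → A
      witness (yes a) _  = a
      witness (no _)  ()

  GreedyFallsShortBy : ℚ → Set
  GreedyFallsShortBy ε =
    Σ ℕ λ n → Σ (Graph n) λ G → Connected G ×
      Σ ℕ λ k → 1 ≤ k ×
        Σ (Subset n) λ SG → GreedyRun G k SG ×
          Σ (Subset n) λ Sopt → ∣ Sopt ∣ ≡ k ×
            (∀ (S : Subset n) → ∣ S ∣ ≡ k → closeness G S ℚ.≤ closeness G Sopt) ×
            closeness G SG ℚ.< ε ℚ.* closeness G Sopt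

  module DoubleBroom (m t : ℕ) .{{_ : NonZero m}} where

    P T h n c : ℕ
    P = suc (2 * t)
    T = suc P
    h = suc t
    n = m + (P + m)
    c = m + t

    -- Vertices 0 … m - 1 are the left leaves (level 0), m … m + P - 1 the path (levels 1 … P)
    -- and the last m vertices the right leaves (level T); adjacency means levels differing by one.
    level : ℕ → ℕ
    level i = (suc i ∸ m) ⊓ T

    T≡2*h : T ≡ 2 * h
    T≡2*h = sym (*-suc 2 t)

    T<n : T < n
    T<n = begin-strict
      T            ≡⟨ +-comm 1 P ⟩
      P + 1        ≤⟨ +-monoʳ-≤ P (>-nonZero⁻¹ m) ⟩
      P + m        <⟨ m<n+m (P + m) (>-nonZero⁻¹ m) ⟩
      m + (P + m)  ∎
      where open ≤-Reasoning

    level≤T : ∀ i → level i ≤ T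
    level≤T i = m⊓n≤n (suc i ∸ m) T

    level-left : ∀ {i} → i < m → level i ≡ 0
    level-left i<m = cong (_⊓ T) (m≤n⇒m∸n≡0 i<m)

    level-path : ∀ {j} → j ≤ P → level (m + j) ≡ suc j
    level-path {j} j≤P = begin
      (suc (m + j) ∸ m) ⊓ T  ≡⟨ cong (λ k → (k ∸ m) ⊓ T) (+-suc m j) ⟨
      (m + suc j ∸ m) ⊓ T    ≡⟨ cong (_⊓ T) (m+n∸m≡n m (suc j)) ⟩
      suc j ⊓ T              ≡⟨ m≤n⇒m⊓n≡m (s≤s j≤P) ⟩
      suc j                  ∎
      where open ≡-Reasoning

    level-right : ∀ {i} → m + P ≤ i → level i ≡ T
    level-right {i} m+P≤i = m≥n⇒m⊓n≡n (m+n≤o⇒m≤o∸n T (begin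
      T + m        ≡⟨ +-comm T m ⟩
      m + T        ≡⟨ +-suc m P ⟩
      suc (m + P)  ≤⟨ s≤s m+P≤i ⟩
      suc i        ∎))
      where open ≤-Reasoning

    level-reflect : ∀ {i} → i < n → level i + level (n ∸ suc i) ≡ T
    level-reflect {i} i<n = clamp-reflect m T (begin
      suc i + suc (n ∸ suc i)  ≡⟨ cong (suc i +_) (+-∸-assoc 1 i<n) ⟨
      suc i + (suc n ∸ suc i)  ≡⟨ m+[n∸m]≡n (<⇒≤ (s≤s i<n)) ⟩
      suc n                    ≡⟨ +-suc m (P + m) ⟨
      m + suc (P + m)          ∎)
      where open ≡-Reasoning

    level-c : level c ≡ h
    level-c = level-path (≤-trans (m≤m+n t (t + 0)) (n≤1+n _))

    level≡h⇒≡c : ∀ {i} → level i ≡ h → i ≡ c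
    level≡h⇒≡c {i} level≡h with ≤-total (suc i ∸ m) T
    ... | inj₂ T≤ = contradiction (trans (sym (m≥n⇒m⊓n≡n T≤)) level≡h) (>⇒≢ h<T)
      where h<T = s≤s (s≤s (m≤m+n t (t + 0)))
    ... | inj₁ ≤T = suc-injective (begin
      suc i            ≡⟨ m+[n∸m]≡n m≤1+i ⟨
      m + (suc i ∸ m)  ≡⟨ cong (m +_) 1+i∸m≡h ⟩
      m + h            ≡⟨ +-suc m t ⟩
      suc c            ∎)
      where
      open ≡-Reasoning
      1+i∸m≡h = trans (sym (m≤n⇒m⊓n≡m ≤T)) level≡h
      m≤1+i : m ≤ suc i
      m≤1+i = ≮⇒≥ λ 1+i<m → contradiction (trans (sym (m≤n⇒m∸n≡0 (<⇒≤ 1+i<m))) 1+i∸m≡h) λ ()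

    index : ℕ → ℕ
    index zero    = 0
    index (suc q) = m + q

    index<n : ∀ {q} → q ≤ T → index q < n
    index<n {zero}  _         = ≤-trans (>-nonZero⁻¹ m) (m≤m+n m (P + m))
    index<n {suc q} (s≤s q≤P) = +-monoʳ-< m (≤-<-trans q≤P (m<m+n P (>-nonZero⁻¹ m)))

    level-index : ∀ {q} → q ≤ T → level (index q) ≡ q
    level-index {zero}  _         = level-left (>-nonZero⁻¹ m)
    level-index {suc q} (s≤s q≤P) = level-path q≤P

    vertexAt : ∀ {q} → q ≤ T → Fin n
    vertexAt q≤T = fromℕ< (index<n q≤T)

    levelᶠ : Fin n → ℕ
    levelᶠ u = level (toℕ u)

    levelᶠ-vertexAt : ∀ {q} (q≤T : q ≤ T) → levelᶠ (vertexAt q≤T) ≡ q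
    levelᶠ-vertexAt q≤T = trans (cong level (toℕ-fromℕ< (index<n q≤T))) (level-index q≤T)

    -- Distinct vertices on a common level are leaves at the same end, at distance 2.
    δ : ℕ → ℕ → ℕ
    δ i j = if does (i ≟ j) then 0 else if does (level i ≟ level j) then 2 else ∣ level i - level j ∣

    δ-self : ∀ {i j} → i ≡ j → δ i j ≡ 0
    δ-self {i} {j} i≡j rewrite dec-true (i ≟ j) i≡j = refl

    δ-sameLevel : ∀ {i j} → i ≢ j → level i ≡ level j → δ i j ≡ 2
    δ-sameLevel {i} {j} i≢j same rewrite dec-false (i ≟ j) i≢j | dec-true (level i ≟ level j) same = refl

    δ-diffLevel : ∀ {i j} → level i ≢ level j → δ i j ≡ ∣ level i - level j ∣
    δ-diffLevel {i} {j} diff rewrite dec-false (i ≟ j) (diff ∘ cong level) | dec-false (level i ≟ level j) diff = refl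

    δ≡0⇒≡ : ∀ {i j} → δ i j ≡ 0 → i ≡ j
    δ≡0⇒≡ {i} {j} δ≡0 with i ≟ j | level i ≟ level j
    ... | yes i≡j | _         = i≡j
    ... | no  i≢j | yes same  = contradiction (trans (sym (δ-sameLevel i≢j same)) δ≡0) λ ()
    ... | no  _   | no  diff  = contradiction (∣m-n∣≡0⇒m≡n (trans (sym (δ-diffLevel diff)) δ≡0)) diff

    δ-sym : ∀ i j → δ i j ≡ δ j i
    δ-sym i j with i ≟ j | level i ≟ level j
    ... | yes i≡j | _        = trans (δ-self i≡j) (sym (δ-self (sym i≡j)))
    ... | no  i≢j | yes same = trans (δ-sameLevel i≢j same) (sym (δ-sameLevel (i≢j ∘ sym) (sym same)))
    ... | no  _   | no  diff = trans (δ-diffLevel diff) (trans (∣-∣-comm (level i) (level j)) (sym (δ-diffLevel (diff ∘ sym))))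

    ∣level-level∣≤δ : ∀ i j → ∣ level i - level j ∣ ≤ δ i j
    ∣level-level∣≤δ i j with i ≟ j | level i ≟ level j
    ... | yes refl | _        = ≤-reflexive (trans (∣n-n∣≡0 (level i)) (sym (δ-self {i} refl)))
    ... | no  i≢j  | yes same = ≤-trans (≤-reflexive (trans (cong (∣ level i -_∣) (sym same)) (∣n-n∣≡0 (level i)))) z≤n
    ... | no  _    | no  diff = ≤-reflexive (sym (δ-diffLevel diff))

    δ≤T : ∀ i j → δ i j ≤ T
    δ≤T i j with i ≟ j | level i ≟ level j
    ... | yes i≡j | _        = ≤-trans (≤-reflexive (δ-self i≡j)) z≤n
    ... | no  i≢j | yes same = ≤-trans (≤-reflexive (δ-sameLevel i≢j same)) (s≤s (s≤s z≤n))
    ... | no  _   | no  diff = ≤-trans (≤-reflexive (δ-diffLevel diff)) (≤-trans (∣m-n∣≤m⊔n (level i) (level j)) (⊔-lub (level≤T i) (level≤T j)))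

    δ-edge : ∀ {i j} k → ∣ level i - level j ∣ ≡ 1 → δ i k ≤ suc (δ j k)
    δ-edge {i} {j} k ∣i-j∣≡1 with i ≟ k | level i ≟ level k
    ... | yes i≡k | _        = ≤-trans (≤-reflexive (δ-self i≡k)) z≤n
    ... | no  i≢k | yes same = ≤-trans (≤-reflexive (δ-sameLevel i≢k same)) (s≤s (n≢0⇒n>0 (j≢k ∘ δ≡0⇒≡)))
      where
      j≢k : j ≢ k
      j≢k refl with () ← trans (sym (trans (cong (∣ level i -_∣) (sym same)) (∣n-n∣≡0 (level i)))) ∣i-j∣≡1
    ... | no  _   | no  diff = begin
      δ i k                                          ≡⟨ δ-diffLevel diff ⟩
      ∣ level i - level k ∣                          ≤⟨ ∣-∣-triangle (level i) (level j) (level k) ⟩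
      ∣ level i - level j ∣ + ∣ level j - level k ∣  ≡⟨ cong (_+ ∣ level j - level k ∣) ∣i-j∣≡1 ⟩
      suc ∣ level j - level k ∣                      ≤⟨ s≤s (∣level-level∣≤δ j k) ⟩
      suc (δ j k)                                    ∎
      where open ≤-Reasoning

    broom : Graph n
    broom = levelGraph levelᶠ

    δᶠ : Fin n → Fin n → ℕ
    δᶠ u v = δ (toℕ u) (toℕ v)

    step-to-level : ∀ {u x q d} (q≤T : q ≤ T) → ∣ levelᶠ u - q ∣ ≡ 1 → ∣ q - levelᶠ x ∣ ≡ suc d →
                    ∃[ v ] Adj broom u v × δᶠ v x ≡ suc d
    step-to-level {u} {x} {q} q≤T ∣u-q∣≡1 ∣q-x∣≡1+d =
      v , levelGraph-adj⁺ levelᶠ (trans (cong (∣ levelᶠ u -_∣) level-v) ∣u-q∣≡1) ,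
      trans (δ-diffLevel v≁x) (trans (cong (∣_- levelᶠ x ∣) level-v) ∣q-x∣≡1+d)
      where
      v = vertexAt q≤T
      level-v = levelᶠ-vertexAt q≤T
      v≁x : levelᶠ v ≢ levelᶠ x
      v≁x same with () ← trans (sym ∣q-x∣≡1+d) (trans (cong (∣ q -_∣) (trans (sym same) level-v)) (∣n-n∣≡0 q))

    δᶠ-descent : ∀ {u x d} → δᶠ u x ≡ suc d → ∃[ v ] Adj broom u v × δᶠ v x ≡ d
    δᶠ-descent {u} {x} {d} δ≡1+d with toℕ u ≟ toℕ x | levelᶠ u ≟ levelᶠ x
    ... | yes u≡x | _ with () ← trans (sym (δ-self u≡x)) δ≡1+d
    ... | no  u≢x | yes same
      with refl ← suc-injective (trans (sym δ≡1+d) (δ-sameLevel u≢x same))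
      with ∃-neighbour {levelᶠ u} {T} (s≤s z≤n) (level≤T (toℕ u))
    ...   | q , q≤T , ∣u-q∣≡1 =
            step-to-level q≤T ∣u-q∣≡1 (trans (cong (∣ q -_∣) (sym same)) (trans (∣-∣-comm q (levelᶠ u)) ∣u-q∣≡1))
    δᶠ-descent {u} {x} {zero} δ≡1 | no _ | no diff =
      x , levelGraph-adj⁺ levelᶠ (trans (sym (δ-diffLevel diff)) δ≡1) , δ-self {toℕ x} refl
    δᶠ-descent {u} {x} {suc d} δ≡2+d | no _ | no diff
      with ∃-step-toward (levelᶠ u) (levelᶠ x) (trans (sym (δ-diffLevel diff)) δ≡2+d)
    ... | q , q≤u⊔x , ∣u-q∣≡1 , ∣q-x∣≡1+d =
          step-to-level (≤-trans q≤u⊔x (⊔-lub (level≤T (toℕ u)) (level≤T (toℕ x)))) ∣u-q∣≡1 ∣q-x∣≡1+d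

    open DistanceCertificate broom δᶠ
      (λ u v → <-≤-trans (s≤s (δ≤T (toℕ u) (toℕ v))) T<n) (λ u → δ-self {toℕ u} refl) (toℕ-injective ∘ δ≡0⇒≡)
      (λ x u~v → δ-edge (toℕ x) (levelGraph-adj⁻ levelᶠ u~v)) δᶠ-descent

    broom-connected : Connected broom
    broom-connected = connected

    δ-triangleℕ : ∀ {i j k} → i < n → j < n → k < n → δ i k ≤ δ i j + δ j k
    δ-triangleℕ i<n j<n k<n with δ-triangle (fromℕ< i<n) (fromℕ< j<n) (fromℕ< k<n)
    ... | triangle rewrite toℕ-fromℕ< i<n | toℕ-fromℕ< j<n | toℕ-fromℕ< k<n = triangle

    δ-adjacent : ∀ {i j} → ∣ level i - level j ∣ ≡ 1 → δ i j ≡ 1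
    δ-adjacent {i} {j} ∣i-j∣≡1 = trans (δ-diffLevel i≁j) ∣i-j∣≡1
      where
      i≁j : level i ≢ level j
      i≁j same with () ← trans (sym ∣i-j∣≡1) (trans (cong (∣ level i -_∣) (sym same)) (∣n-n∣≡0 (level i)))

    halfway : ∀ {i} → i < n → 2 * δ i c ≤ δ i (n ∸ suc i)
    halfway {i} i<n with level i ≟ h
    ... | yes level≡h rewrite level≡h⇒≡c level≡h | δ-self {c} refl = z≤n
    ... | no  level≢h = ≤-reflexive (begin
      2 * δ i c                  ≡⟨ cong (2 *_) (δ-diffLevel λ same → level≢h (trans same level-c)) ⟩
      2 * ∣ level i - level c ∣  ≡⟨ cong (λ k → 2 * ∣ level i - k ∣) level-c ⟩
      2 * ∣ level i - h ∣        ≡⟨ ∣a-b∣≡2*∣a-h∣ (level i) (level i') h (trans (level-reflect i<n) T≡2*h) ⟨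
      ∣ level i - level i' ∣     ≡⟨ δ-diffLevel i≁i' ⟨
      δ i i'                     ∎)
      where
      open ≡-Reasoning
      i' = n ∸ suc i
      i≁i' : level i ≢ level i'
      i≁i' same = level≢h (*-cancelˡ-≡ (level i) h 2 (begin
        2 * level i         ≡⟨ cong (level i +_) (+-identityʳ (level i)) ⟩
        level i + level i   ≡⟨ cong (level i +_) same ⟩
        level i + level i'  ≡⟨ level-reflect i<n ⟩
        T                   ≡⟨ T≡2*h ⟩
        2 * h               ∎))

    c<n : c < n
    c<n = +-monoʳ-< m (≤-trans (s≤s (m≤m+n t (t + 0))) (m≤m+n P m))

    centre : Fin n
    centre = fromℕ< c<n

    farness-singleton : ∀ w → farness broom (⊥ ∪ ⁅ w ⁆) ≡ ∑[ i < n ] δ i (toℕ w)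
    farness-singleton w = ∑-tabulate _ (λ i → δ i (toℕ w)) (λ u → dist-singleton {u} {w})

    farness-pair : ∀ a b → farness broom ((⊥ ∪ ⁅ a ⁆) ∪ ⁅ b ⁆) ≡ ∑[ i < n ] (δ i (toℕ a) ⊓ δ i (toℕ b))
    farness-pair a b = ∑-tabulate _ (λ i → δ i (toℕ a) ⊓ δ i (toℕ b)) (λ u → dist-pair {u} {a} {b})

    centre-median : ∀ w → farness broom (⊥ ∪ ⁅ centre ⁆) ≤ farness broom (⊥ ∪ ⁅ w ⁆)
    centre-median w = begin
      farness broom (⊥ ∪ ⁅ centre ⁆)  ≡⟨ farness-singleton centre ⟩
      ∑[ i < n ] δ i (toℕ centre)     ≡⟨ cong (λ k → ∑[ i < n ] δ i k) (toℕ-fromℕ< c<n) ⟩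
      ∑[ i < n ] δ i c                ≤⟨ halfway-median n δ δ-sym triangle halfway ⟩
      ∑[ i < n ] δ i (toℕ w)          ≡⟨ farness-singleton w ⟨
      farness broom (⊥ ∪ ⁅ w ⁆)       ∎
      where
      open ≤-Reasoning
      triangle : ∀ {i} → i < n → δ i (n ∸ suc i) ≤ δ i (toℕ w) + δ (toℕ w) (n ∸ suc i)
      triangle {i} i<n = δ-triangleℕ i<n (toℕ<n w) (≤-trans (≤-reflexive (sym (+-∸-assoc 1 i<n))) (m∸n≤m n i))

    leaf : Fin n
    leaf = vertexAt z≤n

    leaf∉⁅centre⁆ : leaf ∉ ⊥ ∪ ⁅ centre ⁆
    leaf∉⁅centre⁆ leaf∈ = 0≢1+n (begin
      0              ≡⟨ levelᶠ-vertexAt z≤n ⟨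
      levelᶠ leaf    ≡⟨ cong levelᶠ (x∈⊥∪⁅y⁆⇒x≡y leaf∈) ⟩
      levelᶠ centre  ≡⟨ cong level (toℕ-fromℕ< c<n) ⟩
      level c        ≡⟨ level-c ⟩
      h              ∎)
      where open ≡-Reasoning

    greedy-picks-centre : GreedyRun broom 1 (⊥ ∪ ⁅ centre ⁆)
    greedy-picks-centre = step centre start ∉⊥ centre-best
      where
      centre-best : ∀ w → w ∉ ⊥ → closeness broom (⊥ ∪ ⁅ w ⁆) ℚ.≤ closeness broom (⊥ ∪ ⁅ centre ⁆)
      centre-best w _ rewrite ∣⊥∪⁅x⁆∣≡1 w | ∣⊥∪⁅x⁆∣≡1 centre =
        ratio-antitone (n ∸ 1) (1≤farness broom leaf∉⁅centre⁆) (centre-median w)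

    level∸level≤δ : ∀ i j → level i ∸ level j ≤ δ i j
    level∸level≤δ i j = ≤-trans (m∸n≤∣m-n∣ (level i) (level j)) (∣level-level∣≤δ i j)

    level∸level≤δ′ : ∀ i j → level j ∸ level i ≤ δ i j
    level∸level≤δ′ i j = ≤-trans (level∸level≤δ j i) (≤-reflexive (δ-sym j i))

    T∸h≡h : T ∸ h ≡ h
    T∸h≡h = trans (cong (_∸ h) T≡2*h) (trans (m+n∸m≡n h (h + 0)) (+-identityʳ h))

    m*h≤farness-centre-pair : ∀ w → m * h ≤ farness broom ((⊥ ∪ ⁅ centre ⁆) ∪ ⁅ w ⁆)
    m*h≤farness-centre-pair w rewrite farness-pair centre w | toℕ-fromℕ< c<n with h ≤? levelᶠ w
    ... | yes h≤w = begin
      m * h                             ≤⟨ *≤∑ m h (λ i<m → ≤-reflexive (cong (h ∸_) (sym (level-left i<m)))) ⟩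
      ∑[ i < m ] (h ∸ level i)          ≤⟨ ∑-prefix m (P + m) (λ i → h ∸ level i) ⟩
      ∑[ i < n ] (h ∸ level i)          ≤⟨ ∑-mono-≤ n (λ {i} _ → ⊓-glb (toward-c i) (toward-w i)) ⟩
      ∑[ i < n ] (δ i c ⊓ δ i (toℕ w))  ∎
      where
      open ≤-Reasoning
      toward-c : ∀ i → h ∸ level i ≤ δ i c
      toward-c i = subst (λ k → k ∸ level i ≤ δ i c) level-c (level∸level≤δ′ i c)
      toward-w : ∀ i → h ∸ level i ≤ δ i (toℕ w)
      toward-w i = ≤-trans (∸-monoˡ-≤ (level i) h≤w) (level∸level≤δ′ i (toℕ w))
    ... | no h≰w = begin
      m * h                                 ≤⟨ *≤∑ m h (λ _ → ≤-reflexive (sym right-leaf)) ⟩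
      ∑[ j < m ] (level (m + (P + j)) ∸ h)  ≤⟨ ∑-suffix P m (λ j → level (m + j) ∸ h) ⟩
      ∑[ j < P + m ] (level (m + j) ∸ h)    ≤⟨ ∑-suffix m (P + m) (λ i → level i ∸ h) ⟩
      ∑[ i < n ] (level i ∸ h)              ≤⟨ ∑-mono-≤ n (λ {i} _ → ⊓-glb (away-c i) (away-w i)) ⟩
      ∑[ i < n ] (δ i c ⊓ δ i (toℕ w))      ∎
      where
      open ≤-Reasoning
      right-leaf : ∀ {j} → level (m + (P + j)) ∸ h ≡ h
      right-leaf {j} = trans (cong (_∸ h) (level-right (+-monoʳ-≤ m (m≤m+n P j)))) T∸h≡h
      away-c : ∀ i → level i ∸ h ≤ δ i c
      away-c i = subst (λ k → level i ∸ k ≤ δ i c) level-c (level∸level≤δ i c)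
      away-w : ∀ i → level i ∸ h ≤ δ i (toℕ w)
      away-w i = ≤-trans (∸-monoʳ-≤ (level i) (<⇒≤ (≰⇒> h≰w))) (level∸level≤δ i (toℕ w))

    leftEnd rightEnd : Fin n
    leftEnd  = vertexAt {1} (s≤s z≤n)
    rightEnd = vertexAt {P} (n≤1+n P)

    ends : Subset n
    ends = (⊥ ∪ ⁅ leftEnd ⁆) ∪ ⁅ rightEnd ⁆

    ∣ends∣≡2 : 1 ≤ t → ∣ ends ∣ ≡ 2
    ∣ends∣≡2 1≤t = ∣pair∣≡2 λ left≡right → <⇒≢ (s≤s (≤-trans 1≤t (m≤m+n t (t + 0)))) (begin
      1                ≡⟨ levelᶠ-vertexAt (s≤s z≤n) ⟨
      levelᶠ leftEnd   ≡⟨ cong levelᶠ left≡right ⟩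
      levelᶠ rightEnd  ≡⟨ levelᶠ-vertexAt (n≤1+n P) ⟩
      P                ∎)
      where open ≡-Reasoning

    leaf∉ends : leaf ∉ ends
    leaf∉ends leaf∈ with x∈pair⇒ leaf∈
    ... | inj₁ leaf≡left  = 0≢1+n (trans (sym (levelᶠ-vertexAt z≤n)) (trans (cong levelᶠ leaf≡left) (levelᶠ-vertexAt (s≤s z≤n))))
    ... | inj₂ leaf≡right = 0≢1+n (trans (sym (levelᶠ-vertexAt z≤n)) (trans (cong levelᶠ leaf≡right) (levelᶠ-vertexAt (n≤1+n P))))

    farness-ends≤ : farness broom ends ≤ m + (P * T + m)
    farness-ends≤ rewrite farness-pair leftEnd rightEnd = begin
      ∑[ i < n ] F i                                                          ≡⟨ ∑-++-++ m P m F ⟩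
      ∑[ i < m ] F i + (∑[ j < P ] F (m + j) + ∑[ j < m ] F (m + (P + j)))  ≤⟨ +-mono-≤ (∑≤* m 1 near-left) (+-mono-≤ (∑≤* P T path) (∑≤* m 1 near-right)) ⟩
      m * 1 + (P * T + m * 1)                                                 ≡⟨ cong₂ (λ x y → x + (P * T + y)) (*-identityʳ m) (*-identityʳ m) ⟩
      m + (P * T + m)                                                         ∎
      where
      open ≤-Reasoning
      a = toℕ leftEnd
      b = toℕ rightEnd
      F : ℕ → ℕ
      F i = δ i a ⊓ δ i b
      near-left : ∀ {i} → i < m → F i ≤ 1
      near-left i<m = ≤-trans (m⊓n≤m _ _) (≤-reflexive (δ-adjacent
        (cong₂ ∣_-_∣ (level-left i<m) (levelᶠ-vertexAt (s≤s z≤n)))))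
      path : ∀ {j} → j < P → F (m + j) ≤ T
      path {j} _ = ≤-trans (m⊓n≤m _ _) (δ≤T (m + j) a)
      near-right : ∀ {j} → j < m → F (m + (P + j)) ≤ 1
      near-right {j} _ = ≤-trans (m⊓n≤n _ _) (≤-reflexive (δ-adjacent (begin-equality
        ∣ level (m + (P + j)) - levelᶠ rightEnd ∣  ≡⟨ cong₂ ∣_-_∣ (level-right (+-monoʳ-≤ m (m≤m+n P j))) (levelᶠ-vertexAt (n≤1+n P)) ⟩
        ∣ T - P ∣                                  ≡⟨ ∣-∣-comm T P ⟩
        ∣ P - T ∣                                  ≡⟨ ∣n-1+n∣≡1 P ⟩
        1                                          ∎)))

    secondPick : ∃[ v ] v ∉ ⊥ ∪ ⁅ centre ⁆ × GreedyRun broom 2 ((⊥ ∪ ⁅ centre ⁆) ∪ ⁅ v ⁆)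
    secondPick = greedy-step greedy-picks-centre leaf∉⁅centre⁆

    greedyPair : Subset n
    greedyPair = (⊥ ∪ ⁅ centre ⁆) ∪ ⁅ proj₁ secondPick ⁆

    greedy-run : GreedyRun broom 2 greedyPair
    greedy-run = proj₂ (proj₂ secondPick)

    ∣greedyPair∣≡2 : ∣ greedyPair ∣ ≡ 2
    ∣greedyPair∣≡2 = ∣pair∣≡2 λ centre≡v → proj₁ (proj₂ secondPick) (subst (_∈ ⊥ ∪ ⁅ centre ⁆) centre≡v (x∈⊥∪⁅x⁆ centre))

    m*h≤farness-greedyPair : m * h ≤ farness broom greedyPair
    m*h≤farness-greedyPair = m*h≤farness-centre-pair (proj₁ secondPick)

    falls-short : ∀ {p q} .(cp : Coprime (suc p) (suc q)) → 1 ≤ t →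
                  (m + (P * T + m)) * suc q < suc p * (m * h) → GreedyFallsShortBy (mkℚ (ℤ.+ suc p) q cp)
    falls-short {p} {q} cp 1≤t leaves-dominate =
      n , broom , broom-connected , 2 , s≤s z≤n , greedyPair , greedy-run , Sopt , ∣Sopt∣≡2 , best , gap
      where
      ε = mkℚ (ℤ.+ suc p) q cp
      opt = optimum broom {S₀ = ends} (∣ends∣≡2 1≤t)
      Sopt = proj₁ opt
      ∣Sopt∣≡2 = proj₁ (proj₂ opt)
      best = proj₂ (proj₂ opt)
      N = n ∸ 2
      1≤N : 1 ≤ N
      1≤N = m<n⇒0<n∸m (≤-<-trans (s≤s (s≤s z≤n)) T<n)
      1≤m*h : 1 ≤ m * h
      1≤m*h = *-mono-≤ (>-nonZero⁻¹ m) (s≤s z≤n)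
      gap : closeness broom greedyPair ℚ.< ε ℚ.* closeness broom Sopt
      gap = begin-strict
        closeness broom greedyPair          ≡⟨ cong (λ k → ratio (n ∸ k) (farness broom greedyPair)) ∣greedyPair∣≡2 ⟩
        ratio N (farness broom greedyPair)  ≤⟨ ratio-antitone N 1≤m*h m*h≤farness-greedyPair ⟩
        ratio N (m * h)                     <⟨ ratio<ε*ratio {N} {m * h} {m + (P * T + m)} cp 1≤N 1≤m*h (≤-trans (>-nonZero⁻¹ m) (m≤m+n m _)) leaves-dominate ⟩
        ε ℚ.* ratio N (m + (P * T + m))     ≤⟨ ℚ.*-monoˡ-≤-nonNeg ε (ratio-antitone N (1≤farness broom leaf∉ends) farness-ends≤) ⟩
        ε ℚ.* ratio N (farness broom ends)  ≡⟨ cong (λ k → ε ℚ.* ratio (n ∸ k) (farness broom ends)) (∣ends∣≡2 1≤t) ⟨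
        ε ℚ.* closeness broom ends          ≤⟨ ℚ.*-monoˡ-≤-nonNeg ε (best ends (∣ends∣≡2 1≤t)) ⟩
        ε ℚ.* closeness broom Sopt          ∎
        where open ℚ.≤-Reasoning

  greedy-falls-short : ∀ p q .(cp : Coprime (suc p) (suc q)) → GreedyFallsShortBy (mkℚ (ℤ.+ suc p) q cp)
  greedy-falls-short p q cp = DoubleBroom.falls-short m t cp (s≤s z≤n) leaves-dominate
    where
    -- m = P (P + 1) bounds the path's share of the farness of the ends by m, and
    -- t = 3 (q + 1) makes m (t + 1) exceed the resulting 3m (q + 1).
    t = 3 * suc q
    P = suc (2 * t)
    m = P * suc P
    leaves-dominate : (m + (m + m)) * suc q < suc p * (m * suc t)
    leaves-dominate = begin-strict
      (m + (m + m)) * suc q  ≡⟨ [m+m+m]*s≡m*[3*s] m (suc q) ⟩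
      m * t                  <⟨ *-monoʳ-< m (n<1+n t) ⟩
      m * suc t              ≤⟨ m≤n*m (m * suc t) (suc p) ⟩
      suc p * (m * suc t)    ∎
      where open ≤-Reasoning

open import Defs
open import Data.Nat using (ℕ) renaming (_≤_ to _≤ℕ_)
open import Data.Fin.Subset using (Subset; ∣_∣)
open import Data.Product using (Σ; _×_)
open import Data.Rational using (ℚ; 0ℚ; _<_; _≤_; _*_)
open import Relation.Binary.PropositionalEquality using (_≡_)
open import Data.Nat using (zero; suc)
open import Data.Integer using (+_; -[1+_]; +<+)
open import Data.Rational using (mkℚ; *<*)
open GreedyCounterexample using (greedy-falls-short)

theorem2 : (ε : ℚ) → 0ℚ < ε →
    Σ ℕ λ n → Σ (Graph n) λ G → Connected G ×
      Σ ℕ λ k → 1 ≤ℕ k ×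
        Σ (Subset n) λ SG → GreedyRun G k SG ×
          Σ (Subset n) λ Sopt → ∣ Sopt ∣ ≡ k ×
            (∀ (S : Subset n) → ∣ S ∣ ≡ k → closeness G S ≤ closeness G Sopt) ×
            closeness G SG < ε * closeness G Sopt
theorem2 (mkℚ (+ suc p) q cp) _ = greedy-falls-short p q cp
theorem2 (mkℚ (+ zero) _ _) (*<* (+<+ ()))
theorem2 (mkℚ -[1+ _ ] _ _) (*<* ())
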